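{- Let $n,r,o,g$ be integers with $o\ge1$, $g\ge0$, $n\ge o$, $0\le r\le n$, and let $\ell\sim\mathbf{coll}(n,r,o,g)$. Then for every integer $k\ge 0$: if $k\le\frac{n-r}{o}$ and $g>0$, then $\Pr(\ell\ge k)=\frac{(n-r)!}{(n-r-ko)!}\prod_{j=0}^{o-1}\frac{(n-g-j)!^{(g)}}{(n+g(k-1)-j)!^{(g)}}$; if $k\le\frac{n-r}{o}$ and $g=0$, then $\Pr(\ell\ge k)=\frac{(n-r)!}{(n-r-ko)!}\prod_{j=0}^{o-1}\frac{1}{(n-j)^k}$; and if $k>\frac{n-r}{o}$, then $\Pr(\ell\ge k)=0$.
   Context: The distribution $\mathbf{coll}(n,r,o,g)$ is defined by the following process. Initially there is a population of $n$ molecules, of which $r$ are colored red and $n-r$ green. In each step ("reaction"), $o$ distinct molecules are chosen uniformly at random from the current population (every $o$-element subset equally likely); they are removed and replaced by $o+g$ new molecules, all colored red (so the population grows by $g$ per step). The collision index is the number of steps executed before the first step in which some chosen molecule is red; $\mathbf{coll}(n,r,o,g)$ is the distribution of the collision index. (In the paper this arises as the collision index of a uniformly reactive CRN of order $o$ and generativity $g$ run under Gillespie kinetics from a configuration of $n$ molecules, $r$ red, where reactions consume uniformly random copies of their reactant species and all products are colored red.) The multifactorial is $x!^{(g)}=x(x-g)(x-2g)\cdots$, continuing down to and including the last positive term (the empty product, equal to $1$, if $x\le 0$). -}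

module Defs where

open import Data.Nat using (ℕ; zero; suc; _+_; _*_; _∸_; _≤_)
open import Data.Bool using (Bool; true; false; not)
open import Data.List using (List; []; _∷_; _++_; replicate; length; filter; map; foldr)
open import Data.Product using (_×_; _,_; proj₁; proj₂)
open import Data.Integer using (+_)
open import Data.Rational using (ℚ; 0ℚ; 1ℚ; _/_) renaming (_+_ to _+ℚ_; _*_ to _*ℚ_)
open import Relation.Nullary.Decidable using (does)
import Data.Nat as ℕ

-- The process coll(n,r,o,g).
-- A population is a list of molecule colours (true = red, false = green).

-- All ways to choose a subset of the molecules (each subset of positions
-- exactly once), returned as (chosen molecules , remaining molecules).
splits : List Bool → List (List Bool × List Bool)
splits []       = ([] , []) ∷ []
splits (c ∷ cs) =
  map (λ p → (c ∷ proj₁ p , proj₂ p)) (splits cs) ++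
  map (λ p → (proj₁ p , c ∷ proj₂ p)) (splits cs)

oSplits : ℕ → List Bool → List (List Bool × List Bool)
oSplits o c = filter (λ p → length (proj₁ p) ℕ.≟ o) (splits c)

allGreen : List Bool → Bool
allGreen []       = true
allGreen (c ∷ cs) = not c Data.Bool.∧ allGreen cs

-- a / b as a rational number (b = 0 gives 0 by convention; never used)
_/ℕ_ : ℕ → ℕ → ℚ
a /ℕ zero  = 0ℚ
a /ℕ suc b = (+ a) / suc b

divℚℕ : ℚ → ℕ → ℚ
divℚℕ q zero    = 0ℚ
divℚℕ q (suc b) = q *ℚ ((+ 1) / suc b)

sumℚ : List ℚ → ℚ
sumℚ = foldr _+ℚ_ 0ℚ

-- ProbNoCollision o g k c = probability that, starting from population c,
-- the first k reactions of the process all choose only green molecules,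
-- i.e. Pr(collision index ≥ k).
ProbNoCollision : (o g k : ℕ) → List Bool → ℚ
ProbNoCollision o g zero    c = 1ℚ
ProbNoCollision o g (suc k) c =
  divℚℕ
    (sumℚ (map (λ p → ProbNoCollision o g k (proj₂ p ++ replicate (o + g) true))
               (filter (λ p → allGreen (proj₁ p) Data.Bool.≟ true) (oSplits o c))))
    (length (oSplits o c))

initial : (n r : ℕ) → List Bool
initial n r = replicate r true ++ replicate (n ∸ r) false

PrCollGe : (n r o g k : ℕ) → ℚ
PrCollGe n r o g k = ProbNoCollision o g k (initial n r)

-- Multifactorial x!^(g) = x (x-g) (x-2g) ... down to the last positive
-- term; equals 1 when x = 0 (truncated subtraction makes negative
-- arguments 0).  Intended for g ≥ 1 (fuel x suffices then).
mfactAux : ℕ → ℕ → ℕ → ℕ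
mfactAux g zero     x       = 1
mfactAux g (suc f)  zero    = 1
mfactAux g (suc f)  (suc x) = suc x * mfactAux g f (suc x ∸ g)

multifact : ℕ → ℕ → ℕ
multifact x g = mfactAux g x x

prodℚ : ℕ → (ℕ → ℚ) → ℚ
prodℚ zero    f = 1ℚ
prodℚ (suc m) f = prodℚ m f *ℚ f m

-- A step from a population of N molecules, G of them green, avoids a collision
-- with probability C(G,o)/C(N,o), and then leaves N + g molecules of which
-- G - o are green.  So Pr(ℓ ≥ k) depends only on (N, G) and obeys a one-step
-- recursion; unrolled, the binomial ratios telescope to
--   G!/(G - ko)! · ∏_{i<k} (N_i - o)!/N_i!,   N_i = N + g i.
-- Writing (N_i - o)!/N_i! = ∏_{j<o} 1/(N_i - j) and exchanging the products,
-- the inner product over i, ∏_{i<k} 1/(N - j + g i), is a ratio of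
-- g-multifactorials, or 1/(N - j)^k when g = 0.
module Submission where

open import Defs
open import Algebra.Bundles using (CommutativeMonoid)
open import Data.Bool using (Bool; true; false; not; _∧_; if_then_else_; T?)
open import Data.Bool.Properties using (∧-zeroʳ)
open import Data.List using (List; []; _∷_; _++_; map; length; filter; replicate)
open import Data.List.Properties using (length-++; length-replicate)
open import Data.List.Relation.Binary.Permutation.Propositional using (_↭_; prep; ↭-refl; ↭-trans)
open import Data.List.Relation.Binary.Permutation.Propositional.Properties using (↭-length; filter-↭; shift)
open import Data.List.Relation.Unary.All using (All; []; _∷_)
open import Data.List.Relation.Unary.All.Properties using (++⁺; map⁺; filter⁺; all-filter)
open import Data.Nat using (ℕ; zero; suc; _+_; _*_; _∸_; _^_; _≤_; _<_; _>_; _!; z≤n; s≤s; _<?_; >-nonZero)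
open import Data.Nat.Combinatorics
  using (_C_; nCk+nC[k+1]≡[n+1]C[k+1]; nCk≡n!/k![n-k]!; k>n⇒nCk≡0; k![n∸k]!∣n!; [n-k]*[n-k-1]!≡[n-k]!)
open import Data.Nat.DivMod using (_/_; m/n*n≡m)
open import Data.Nat.Properties
open import Data.Nat.Solver using (module +-*-Solver)
open import Data.Product using (_×_; _,_; proj₁; proj₂)
open import Data.Rational using (ℚ; 0ℚ; 1ℚ; toℚᵘ)
open import Function using (_∘_)
open import Relation.Binary.PropositionalEquality
  using (_≡_; refl; sym; trans; cong; cong₂; subst; module ≡-Reasoning)
open import Relation.Nullary using (does; yes; no; contradiction)
open import Relation.Unary using (Pred; Decidable)

import Data.Bool as Bool
import Data.Integer as ℤ
import Data.Integer.Properties as ℤ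
import Data.List.Relation.Unary.All as All
import Data.Nat as ℕ
import Data.Rational as ℚ
import Data.Rational.Properties as ℚ
import Data.Rational.Unnormalised as ℚᵘ
import Data.Rational.Unnormalised.Properties as ℚᵘ
open import Algebra.Properties.CommutativeSemigroup
  (CommutativeMonoid.commutativeSemigroup ℚ.*-1-commutativeMonoid) using (interchange)

open +-*-Solver using (solve; _:*_; _:=_; con)

private
  variable
    A B : Set

toℚᵘ-/ℕ : ∀ a b → toℚᵘ (a /ℕ suc b) ℚᵘ.≃ ℚᵘ.mkℚᵘ (ℤ.+ a) b
toℚᵘ-/ℕ a b = ℚ.toℚᵘ-fromℚᵘ (ℚᵘ.mkℚᵘ (ℤ.+ a) b)

/ℕ-cross : ∀ {a b c d} → 0 < b → 0 < d → a * d ≡ c * b → a /ℕ b ≡ c /ℕ d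
/ℕ-cross {a} {suc b} {c} {suc d} _ _ ad≡cb =
  ℚ.fromℚᵘ-cong {ℚᵘ.mkℚᵘ (ℤ.+ a) b} {ℚᵘ.mkℚᵘ (ℤ.+ c) d} (ℚᵘ.*≡* (begin
    ℤ.+ a ℤ.* ℤ.+ suc d  ≡⟨ ℤ.pos-* a (suc d) ⟨
    ℤ.+ (a * suc d)      ≡⟨ cong ℤ.+_ ad≡cb ⟩
    ℤ.+ (c * suc b)      ≡⟨ ℤ.pos-* c (suc b) ⟩
    ℤ.+ c ℤ.* ℤ.+ suc b  ∎))
  where open ≡-Reasoning

/ℕ-*-/ℕ : ∀ a {b} c {d} → 0 < b → 0 < d → (a /ℕ b) ℚ.* (c /ℕ d) ≡ (a * c) /ℕ (b * d)
/ℕ-*-/ℕ a {suc b} c {suc d} _ _ = ℚ.toℚᵘ-injective (begin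
  toℚᵘ ((a /ℕ suc b) ℚ.* (c /ℕ suc d))       ≈⟨ ℚ.toℚᵘ-homo-* (a /ℕ suc b) (c /ℕ suc d) ⟩
  toℚᵘ (a /ℕ suc b) ℚᵘ.* toℚᵘ (c /ℕ suc d)   ≈⟨ ℚᵘ.*-cong (toℚᵘ-/ℕ a b) (toℚᵘ-/ℕ c d) ⟩
  ℚᵘ.mkℚᵘ (ℤ.+ a ℤ.* ℤ.+ c) (d + b * suc d)  ≡⟨ cong (λ i → ℚᵘ.mkℚᵘ i (d + b * suc d)) (ℤ.pos-* a c) ⟨
  ℚᵘ.mkℚᵘ (ℤ.+ (a * c)) (d + b * suc d)      ≈⟨ toℚᵘ-/ℕ (a * c) (d + b * suc d) ⟨
  toℚᵘ ((a * c) /ℕ (suc b * suc d))          ∎)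
  where open ℚᵘ.≃-Reasoning

1+n/ℕ1 : ∀ n → 1ℚ ℚ.+ (n /ℕ 1) ≡ suc n /ℕ 1
1+n/ℕ1 n = ℚ.toℚᵘ-injective (begin
  toℚᵘ (1ℚ ℚ.+ (n /ℕ 1))                     ≈⟨ ℚ.toℚᵘ-homo-+ 1ℚ (n /ℕ 1) ⟩
  toℚᵘ 1ℚ ℚᵘ.+ toℚᵘ (n /ℕ 1)                 ≈⟨ ℚᵘ.+-congʳ (toℚᵘ 1ℚ) (toℚᵘ-/ℕ n 0) ⟩
  ℚᵘ.1ℚᵘ ℚᵘ.+ ℚᵘ.mkℚᵘ (ℤ.+ n) 0              ≈⟨ ℚᵘ.*≡* (trans (ℤ.*-identityʳ _)
                                                  (trans (cong (ℤ._+_ ℤ.1ℤ) (ℤ.*-identityʳ (ℤ.+ n)))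
                                                         (sym (ℤ.*-identityʳ _)))) ⟩
  ℚᵘ.mkℚᵘ (ℤ.+ suc n) 0                     ≈⟨ toℚᵘ-/ℕ (suc n) 0 ⟨
  toℚᵘ (suc n /ℕ 1)                         ∎)
  where open ℚᵘ.≃-Reasoning

open ≡-Reasoning

n/ℕn≡1 : ∀ {n} → 0 < n → n /ℕ n ≡ 1ℚ
n/ℕn≡1 {n} 0<n = /ℕ-cross {c = 1} 0<n (s≤s z≤n) (trans (*-identityʳ n) (sym (*-identityˡ n)))

0/ℕn≡0 : ∀ n → 0 /ℕ n ≡ 0ℚ
0/ℕn≡0 zero    = refl
0/ℕn≡0 (suc n) = ℚ.0/n≡0 (suc n)

-- This holds for b = 0 as well, both sides being 0 by the conventions of divℚℕ and _/ℕ_.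
divℚℕ-/ℕ1 : ∀ a b q → divℚℕ ((a /ℕ 1) ℚ.* q) b ≡ (a /ℕ b) ℚ.* q
divℚℕ-/ℕ1 a zero    q = sym (ℚ.*-zeroˡ q)
divℚℕ-/ℕ1 a (suc b) q = begin
  ((a /ℕ 1) ℚ.* q) ℚ.* (1 /ℕ suc b)  ≡⟨ ℚ.*-assoc (a /ℕ 1) q (1 /ℕ suc b) ⟩
  (a /ℕ 1) ℚ.* (q ℚ.* (1 /ℕ suc b))  ≡⟨ cong ((a /ℕ 1) ℚ.*_) (ℚ.*-comm q (1 /ℕ suc b)) ⟩
  (a /ℕ 1) ℚ.* ((1 /ℕ suc b) ℚ.* q)  ≡⟨ ℚ.*-assoc (a /ℕ 1) (1 /ℕ suc b) q ⟨
  ((a /ℕ 1) ℚ.* (1 /ℕ suc b)) ℚ.* q  ≡⟨ cong (ℚ._* q) a/1*1/b≡a/b ⟩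
  (a /ℕ suc b) ℚ.* q                 ∎
  where
  a/1*1/b≡a/b : (a /ℕ 1) ℚ.* (1 /ℕ suc b) ≡ a /ℕ suc b
  a/1*1/b≡a/b = trans (/ℕ-*-/ℕ a 1 (s≤s z≤n) (s≤s z≤n))
    (cong₂ _/ℕ_ (*-identityʳ a) (+-identityʳ (suc b)))

sumℚ-map-const : ∀ {f : A → ℚ} {q} {xs} → All (λ x → f x ≡ q) xs →
                 sumℚ (map f xs) ≡ (length xs /ℕ 1) ℚ.* q
sumℚ-map-const {q = q} [] = sym (ℚ.*-zeroˡ q)
sumℚ-map-const {f = f} {q} {x ∷ xs} (fx≡q ∷ all) = begin
  f x ℚ.+ sumℚ (map f xs)                ≡⟨ cong₂ ℚ._+_ fx≡q (sumℚ-map-const all) ⟩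
  q ℚ.+ (length xs /ℕ 1) ℚ.* q           ≡⟨ cong (ℚ._+ (length xs /ℕ 1) ℚ.* q) (ℚ.*-identityˡ q) ⟨
  1ℚ ℚ.* q ℚ.+ (length xs /ℕ 1) ℚ.* q    ≡⟨ ℚ.*-distribʳ-+ q 1ℚ (length xs /ℕ 1) ⟨
  (1ℚ ℚ.+ length xs /ℕ 1) ℚ.* q          ≡⟨ cong (ℚ._* q) (1+n/ℕ1 (length xs)) ⟩
  (suc (length xs) /ℕ 1) ℚ.* q           ∎

prodℚ-cong : ∀ m {f h : ℕ → ℚ} → (∀ {j} → j < m → f j ≡ h j) → prodℚ m f ≡ prodℚ m h
prodℚ-cong zero    f≗h = refl
prodℚ-cong (suc m) f≗h = cong₂ ℚ._*_ (prodℚ-cong m (f≗h ∘ m<n⇒m<1+n)) (f≗h (n<1+n m))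

prodℚ-* : ∀ m (f h : ℕ → ℚ) → prodℚ m (λ j → f j ℚ.* h j) ≡ prodℚ m f ℚ.* prodℚ m h
prodℚ-* zero    f h = refl
prodℚ-* (suc m) f h = trans (cong (ℚ._* (f m ℚ.* h m)) (prodℚ-* m f h))
  (interchange (prodℚ m f) (prodℚ m h) (f m) (h m))

prodℚ-sucˡ : ∀ m (f : ℕ → ℚ) → prodℚ (suc m) f ≡ f 0 ℚ.* prodℚ m (f ∘ suc)
prodℚ-sucˡ zero    f = trans (ℚ.*-identityˡ (f 0)) (sym (ℚ.*-identityʳ (f 0)))
prodℚ-sucˡ (suc m) f = trans (cong (ℚ._* f (suc m)) (prodℚ-sucˡ m f))
  (ℚ.*-assoc (f 0) (prodℚ m (f ∘ suc)) (f (suc m)))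

prodℚ-1 : ∀ n → prodℚ n (λ _ → 1ℚ) ≡ 1ℚ
prodℚ-1 zero    = refl
prodℚ-1 (suc n) = cong (ℚ._* 1ℚ) (prodℚ-1 n)

prodℚ-swap : ∀ m n (f : ℕ → ℕ → ℚ) →
  prodℚ m (λ i → prodℚ n (f i)) ≡ prodℚ n (λ j → prodℚ m (λ i → f i j))
prodℚ-swap zero    n f = sym (prodℚ-1 n)
prodℚ-swap (suc m) n f = trans (cong (ℚ._* prodℚ n (f m)) (prodℚ-swap m n f))
  (sym (prodℚ-* n (λ j → prodℚ m (λ i → f i j)) (f m)))

prodℚ-arithmetic-sucˡ : ∀ k (h : ℕ → ℚ) N g →
  prodℚ (suc k) (λ i → h (N + g * i)) ≡ h N ℚ.* prodℚ k (λ i → h (N + g + g * i))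
prodℚ-arithmetic-sucˡ k h N g = trans (prodℚ-sucˡ k (λ i → h (N + g * i)))
  (cong₂ ℚ._*_ (cong h (trans (cong (N +_) (*-zeroʳ g)) (+-identityʳ N)))
               (prodℚ-cong k (λ {i} _ → cong h (trans (cong (N +_) (*-suc g i)) (sym (+-assoc N g (g * i)))))))

countᵇ : (A → Bool) → List A → ℕ
countᵇ p []       = 0
countᵇ p (x ∷ xs) = if p x then suc (countᵇ p xs) else countᵇ p xs

countᵇ-++ : ∀ (p : A → Bool) xs ys → countᵇ p (xs ++ ys) ≡ countᵇ p xs + countᵇ p ys
countᵇ-++ p []       ys = refl
countᵇ-++ p (x ∷ xs) ys with p x
... | true  = cong suc (countᵇ-++ p xs ys)
... | false = countᵇ-++ p xs ys

countᵇ-map : ∀ (p : B → Bool) (f : A → B) xs → countᵇ p (map f xs) ≡ countᵇ (p ∘ f) xs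
countᵇ-map p f []       = refl
countᵇ-map p f (x ∷ xs) with p (f x)
... | true  = cong suc (countᵇ-map p f xs)
... | false = countᵇ-map p f xs

countᵇ-none : ∀ {p : A → Bool} → (∀ x → p x ≡ false) → ∀ xs → countᵇ p xs ≡ 0
countᵇ-none p≡false []       = refl
countᵇ-none p≡false (x ∷ xs) rewrite p≡false x = countᵇ-none p≡false xs

length-filter : ∀ {ℓ} {P : Pred A ℓ} (P? : Decidable P) xs → length (filter P? xs) ≡ countᵇ (does ∘ P?) xs
length-filter P? []       = refl
length-filter P? (x ∷ xs) with does (P? x)
... | true  = cong suc (length-filter P? xs)
... | false = length-filter P? xs

countᵇ-filter : ∀ {ℓ} {P : Pred A ℓ} (P? : Decidable P) (q : A → Bool) xs →
                countᵇ q (filter P? xs) ≡ countᵇ (λ x → does (P? x) ∧ q x) xs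
countᵇ-filter P? q []       = refl
countᵇ-filter P? q (x ∷ xs) with does (P? x)
... | false = countᵇ-filter P? q xs
... | true  with q x
...   | true  = cong suc (countᵇ-filter P? q xs)
...   | false = countᵇ-filter P? q xs

countᵇ-↭ : ∀ (p : A → Bool) {xs ys} → xs ↭ ys → countᵇ p xs ≡ countᵇ p ys
countᵇ-↭ p {xs} {ys} xs↭ys = begin
  countᵇ p xs                    ≡⟨ length-filter (T? ∘ p) xs ⟨
  length (filter (T? ∘ p) xs)    ≡⟨ ↭-length (filter-↭ (T? ∘ p) xs↭ys) ⟩
  length (filter (T? ∘ p) ys)    ≡⟨ length-filter (T? ∘ p) ys ⟩
  countᵇ p ys                    ∎

filter-⇒ : ∀ {ℓ ℓ′} {P : Pred A ℓ} {Q : Pred A ℓ′} (P? : Decidable P) {xs} →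
           All (λ x → P x → Q x) xs → All Q (filter P? xs)
filter-⇒ P? {xs} P⇒Q = All.zipWith (λ (f , px) → f px) (filter⁺ P? P⇒Q , all-filter P? xs)

greens : List Bool → ℕ
greens = countᵇ not

greens-replicate-true : ∀ n → greens (replicate n true) ≡ 0
greens-replicate-true zero    = refl
greens-replicate-true (suc n) = greens-replicate-true n

greens-replicate-false : ∀ n → greens (replicate n false) ≡ n
greens-replicate-false zero    = refl
greens-replicate-false (suc n) = cong suc (greens-replicate-false n)

allGreen⇒greens≡length : ∀ a → allGreen a ≡ true → greens a ≡ length a
allGreen⇒greens≡length []           _   = refl
allGreen⇒greens≡length (false ∷ a) eq = cong suc (allGreen⇒greens≡length a eq)

splits-↭ : ∀ c → All (λ p → proj₁ p ++ proj₂ p ↭ c) (splits c)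
splits-↭ []       = ↭-refl ∷ []
splits-↭ (x ∷ xs) = ++⁺ (map⁺ (All.map (prep x) (splits-↭ xs)))
                        (map⁺ (All.map (λ {p} ab↭xs → ↭-trans (shift x (proj₁ p) (proj₂ p)) (prep x ab↭xs)) (splits-↭ xs)))

countᵇ-splits-∷ : ∀ (p : List Bool × List Bool → Bool) x xs →
  countᵇ p (splits (x ∷ xs)) ≡
  countᵇ (λ s → p (x ∷ proj₁ s , proj₂ s)) (splits xs) + countᵇ (λ s → p (proj₁ s , x ∷ proj₂ s)) (splits xs)
countᵇ-splits-∷ p x xs = trans (countᵇ-++ p (map _ (splits xs)) (map _ (splits xs)))
  (cong₂ _+_ (countᵇ-map p _ (splits xs)) (countᵇ-map p _ (splits xs)))

hasSize : ℕ → List Bool × List Bool → Bool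
hasSize m s = does (length (proj₁ s) ℕ.≟ m)

isGreen : List Bool × List Bool → Bool
isGreen s = does (allGreen (proj₁ s) Bool.≟ true)

countᵇ-hasSize-splits : ∀ m c → countᵇ (hasSize m) (splits c) ≡ length c C m
countᵇ-hasSize-splits zero    []       = refl
countᵇ-hasSize-splits (suc m) []       = refl
countᵇ-hasSize-splits zero    (x ∷ xs) = trans (countᵇ-splits-∷ (hasSize 0) x xs)
  (cong₂ _+_ (countᵇ-none (λ _ → refl) (splits xs)) (countᵇ-hasSize-splits 0 xs))
countᵇ-hasSize-splits (suc m) (x ∷ xs) = trans (countᵇ-splits-∷ (hasSize (suc m)) x xs)
  (trans (cong₂ _+_ (countᵇ-hasSize-splits m xs) (countᵇ-hasSize-splits (suc m) xs))
         (nCk+nC[k+1]≡[n+1]C[k+1] (length xs) m))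

countᵇ-greenOfSize-splits : ∀ m c → countᵇ (λ s → hasSize m s ∧ isGreen s) (splits c) ≡ greens c C m
countᵇ-greenOfSize-splits zero    []       = refl
countᵇ-greenOfSize-splits (suc m) []       = refl
countᵇ-greenOfSize-splits m (true ∷ xs) = trans (countᵇ-splits-∷ _ true xs)
  (cong₂ _+_ (countᵇ-none (λ s → ∧-zeroʳ (hasSize m (true ∷ proj₁ s , proj₂ s))) (splits xs))
             (countᵇ-greenOfSize-splits m xs))
countᵇ-greenOfSize-splits zero    (false ∷ xs) = trans (countᵇ-splits-∷ _ false xs)
  (cong₂ _+_ (countᵇ-none (λ _ → refl) (splits xs)) (countᵇ-greenOfSize-splits 0 xs))
countᵇ-greenOfSize-splits (suc m) (false ∷ xs) = trans (countᵇ-splits-∷ _ false xs)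
  (trans (cong₂ _+_ (countᵇ-greenOfSize-splits m xs) (countᵇ-greenOfSize-splits (suc m) xs))
         (nCk+nC[k+1]≡[n+1]C[k+1] (greens xs) m))

length-oSplits : ∀ m c → length (oSplits m c) ≡ length c C m
length-oSplits m c = trans (length-filter _ (splits c)) (countᵇ-hasSize-splits m c)

greenOSplits : ℕ → List Bool → List (List Bool × List Bool)
greenOSplits m c = filter (λ s → allGreen (proj₁ s) Bool.≟ true) (oSplits m c)

length-greenOSplits : ∀ m c → length (greenOSplits m c) ≡ greens c C m
length-greenOSplits m c = trans (length-filter _ (oSplits m c))
  (trans (countᵇ-filter _ isGreen (splits c)) (countᵇ-greenOfSize-splits m c))

module _ (a b : List Bool) {c o} (ab↭c : a ++ b ↭ c) (|a|≡o : length a ≡ o) where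

  length-afterReaction : ∀ g → length (b ++ replicate (o + g) true) ≡ length c + g
  length-afterReaction g = begin
    length (b ++ replicate (o + g) true)        ≡⟨ length-++ b ⟩
    length b + length (replicate (o + g) true)  ≡⟨ cong (length b +_) (length-replicate (o + g)) ⟩
    length b + (o + g)                          ≡⟨ +-assoc (length b) o g ⟨
    length b + o + g                            ≡⟨ cong (_+ g) (+-comm (length b) o) ⟩
    o + length b + g                            ≡⟨ cong (λ m → m + length b + g) |a|≡o ⟨
    length a + length b + g                     ≡⟨ cong (_+ g) (length-++ a) ⟨
    length (a ++ b) + g                         ≡⟨ cong (_+ g) (↭-length ab↭c) ⟩
    length c + g                                ∎

  greens-afterReaction : ∀ g → allGreen a ≡ true → greens (b ++ replicate (o + g) true) ≡ greens c ∸ o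
  greens-afterReaction g green = begin
    greens (b ++ replicate (o + g) true)        ≡⟨ countᵇ-++ not b (replicate (o + g) true) ⟩
    greens b + greens (replicate (o + g) true)  ≡⟨ cong (greens b +_) (greens-replicate-true (o + g)) ⟩
    greens b + 0                                ≡⟨ +-identityʳ (greens b) ⟩
    greens b                                    ≡⟨ m+n∸m≡n o (greens b) ⟨
    o + greens b ∸ o                            ≡⟨ cong (λ m → m + greens b ∸ o) greens-a≡o ⟨
    greens a + greens b ∸ o                     ≡⟨ cong (_∸ o) (countᵇ-++ not a b) ⟨
    greens (a ++ b) ∸ o                         ≡⟨ cong (_∸ o) (countᵇ-↭ not ab↭c) ⟩
    greens c ∸ o                                ∎
    where
    greens-a≡o : greens a ≡ o
    greens-a≡o = trans (allGreen⇒greens≡length a green) |a|≡o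

-- Reduction to the numbers of molecules and of green molecules

noCollision : (o g k N G : ℕ) → ℚ
noCollision o g zero    N G = 1ℚ
noCollision o g (suc k) N G = ((G C o) /ℕ (N C o)) ℚ.* noCollision o g k (N + g) (G ∸ o)

ProbNoCollision≡noCollision : ∀ o g k c → ProbNoCollision o g k c ≡ noCollision o g k (length c) (greens c)
ProbNoCollision≡noCollision o g zero    c = refl
ProbNoCollision≡noCollision o g (suc k) c = begin
  divℚℕ (sumℚ (map next (greenOSplits o c))) (length (oSplits o c))
    ≡⟨ cong₂ divℚℕ (sumℚ-map-const each-next) (length-oSplits o c) ⟩
  divℚℕ ((length (greenOSplits o c) /ℕ 1) ℚ.* q) (length c C o)
    ≡⟨ cong (λ m → divℚℕ ((m /ℕ 1) ℚ.* q) (length c C o)) (length-greenOSplits o c) ⟩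
  divℚℕ (((greens c C o) /ℕ 1) ℚ.* q) (length c C o)
    ≡⟨ divℚℕ-/ℕ1 (greens c C o) (length c C o) q ⟩
  ((greens c C o) /ℕ (length c C o)) ℚ.* q
    ∎
  where
  q : ℚ
  q = noCollision o g k (length c + g) (greens c ∸ o)
  next : List Bool × List Bool → ℚ
  next s = ProbNoCollision o g k (proj₂ s ++ replicate (o + g) true)
  next≡q : ∀ {s} → proj₁ s ++ proj₂ s ↭ c → length (proj₁ s) ≡ o → allGreen (proj₁ s) ≡ true → next s ≡ q
  next≡q {a , b} ab↭c |a|≡o green = trans (ProbNoCollision≡noCollision o g k _)
    (cong₂ (noCollision o g k) (length-afterReaction a b ab↭c |a|≡o g)
                               (greens-afterReaction a b ab↭c |a|≡o g green))
  each-next : All (λ s → next s ≡ q) (greenOSplits o c)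
  each-next = filter-⇒ _ (filter-⇒ _ (All.map next≡q (splits-↭ c)))

-- Solving the recursion

nCk*k!*[n∸k]!≡n! : ∀ {n k} → k ≤ n → (n C k) * (k ! * (n ∸ k) !) ≡ n !
nCk*k!*[n∸k]!≡n! {n} {k} k≤n = begin
  (n C k) * (k ! * (n ∸ k) !)                  ≡⟨ cong (_* (k ! * (n ∸ k) !)) (nCk≡n!/k![n-k]! k≤n) ⟩
  (n ! / (k ! * (n ∸ k) !)) * (k ! * (n ∸ k) !) ≡⟨ m/n*n≡m (k![n∸k]!∣n! k≤n) ⟩
  n !                                           ∎
  where instance _ = k !* (n ∸ k) !≢0

0<nCk : ∀ {n k} → k ≤ n → 0 < n C k
0<nCk {n} {k} k≤n with n C k | nCk*k!*[n∸k]!≡n! k≤n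
... | zero  | 0≡n! = contradiction 0≡n! (<⇒≢ (1≤n! n))
... | suc _ | _    = s≤s z≤n

binomial-ratio : ∀ {o N G D} → o ≤ N → o ≤ G → 0 < D →
  ((G C o) /ℕ (N C o)) ℚ.* (((G ∸ o) !) /ℕ D) ≡ ((G !) /ℕ D) ℚ.* (((N ∸ o) !) /ℕ (N !))
binomial-ratio {o} {N} {G} {D} o≤N o≤G 0<D = begin
  ((G C o) /ℕ (N C o)) ℚ.* (((G ∸ o) !) /ℕ D)  ≡⟨ /ℕ-*-/ℕ (G C o) ((G ∸ o) !) (0<nCk o≤N) 0<D ⟩
  ((G C o) * (G ∸ o) !) /ℕ ((N C o) * D)         ≡⟨ /ℕ-cross (*-mono-< (0<nCk o≤N) 0<D) (*-mono-< 0<D (1≤n! N)) cross ⟩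
  ((G !) * (N ∸ o) !) /ℕ (D * N !)               ≡⟨ /ℕ-*-/ℕ (G !) ((N ∸ o) !) 0<D (1≤n! N) ⟨
  ((G !) /ℕ D) ℚ.* (((N ∸ o) !) /ℕ (N !))      ∎
  where
  cross : (G C o) * (G ∸ o) ! * (D * N !) ≡ (G !) * (N ∸ o) ! * ((N C o) * D)
  cross = begin
    (G C o) * (G ∸ o) ! * (D * N !)
      ≡⟨ cong (λ m → (G C o) * (G ∸ o) ! * (D * m)) (nCk*k!*[n∸k]!≡n! o≤N) ⟨
    (G C o) * (G ∸ o) ! * (D * ((N C o) * (o ! * (N ∸ o) !)))
      ≡⟨ solve 6 (λ cG fG d cN p fN → cG :* fG :* (d :* (cN :* (p :* fN))) := cG :* (p :* fG) :* fN :* (cN :* d))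
               refl (G C o) ((G ∸ o) !) D (N C o) (o !) ((N ∸ o) !) ⟩
    (G C o) * (o ! * (G ∸ o) !) * (N ∸ o) ! * ((N C o) * D)
      ≡⟨ cong (λ m → m * (N ∸ o) ! * ((N C o) * D)) (nCk*k!*[n∸k]!≡n! o≤G) ⟩
    (G !) * (N ∸ o) ! * ((N C o) * D)
      ∎

noCollision-closed : ∀ o g k {N G} → o ≤ N → k * o ≤ G →
  noCollision o g k N G ≡
    ((G !) /ℕ ((G ∸ k * o) !)) ℚ.* prodℚ k (λ i → ((N + g * i ∸ o) !) /ℕ ((N + g * i) !))
noCollision-closed o g zero    {N} {G} _ _ = sym (trans (ℚ.*-identityʳ _) (n/ℕn≡1 (1≤n! G)))
noCollision-closed o g (suc k) {N} {G} o≤N [1+k]o≤G = begin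
  ((G C o) /ℕ (N C o)) ℚ.* noCollision o g k (N + g) (G ∸ o)
    ≡⟨ cong (((G C o) /ℕ (N C o)) ℚ.*_) (noCollision-closed o g k (≤-trans o≤N (m≤m+n N g)) ko≤G∸o) ⟩
  ((G C o) /ℕ (N C o)) ℚ.* ((((G ∸ o) !) /ℕ D) ℚ.* Π)
    ≡⟨ ℚ.*-assoc ((G C o) /ℕ (N C o)) (((G ∸ o) !) /ℕ D) Π ⟨
  (((G C o) /ℕ (N C o)) ℚ.* (((G ∸ o) !) /ℕ D)) ℚ.* Π
    ≡⟨ cong (ℚ._* Π) (binomial-ratio o≤N (≤-trans (m≤m+n o (k * o)) [1+k]o≤G) (1≤n! (G ∸ o ∸ k * o))) ⟩
  (((G !) /ℕ D) ℚ.* (((N ∸ o) !) /ℕ (N !))) ℚ.* Π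
    ≡⟨ ℚ.*-assoc ((G !) /ℕ D) (((N ∸ o) !) /ℕ (N !)) Π ⟩
  ((G !) /ℕ D) ℚ.* ((((N ∸ o) !) /ℕ (N !)) ℚ.* Π)
    ≡⟨ cong₂ (λ m x → ((G !) /ℕ (m !)) ℚ.* x) (∸-+-assoc G o (k * o)) (sym (prodℚ-arithmetic-sucˡ k F N g)) ⟩
  ((G !) /ℕ ((G ∸ suc k * o) !)) ℚ.* prodℚ (suc k) (λ i → F (N + g * i))
    ∎
  where
  F : ℕ → ℚ
  F M = ((M ∸ o) !) /ℕ (M !)
  D = (G ∸ o ∸ k * o) !
  Π = prodℚ k (λ i → F (N + g + g * i))
  ko≤G∸o : k * o ≤ G ∸ o
  ko≤G∸o = subst (_≤ G ∸ o) (m+n∸m≡n o (k * o)) (∸-monoˡ-≤ o [1+k]o≤G)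

noCollision-impossible : ∀ o g k {N G} → G < k * o → noCollision o g k N G ≡ 0ℚ
noCollision-impossible o g (suc k) {N} {G} G<[1+k]o with G <? o
... | yes G<o = begin
  ((G C o) /ℕ (N C o)) ℚ.* R  ≡⟨ cong (λ m → (m /ℕ (N C o)) ℚ.* R) (k>n⇒nCk≡0 G<o) ⟩
  (0 /ℕ (N C o)) ℚ.* R        ≡⟨ cong (ℚ._* R) (0/ℕn≡0 (N C o)) ⟩
  0ℚ ℚ.* R                    ≡⟨ ℚ.*-zeroˡ R ⟩
  0ℚ                          ∎
  where R = noCollision o g k (N + g) (G ∸ o)
... | no G≮o = trans (cong (((G C o) /ℕ (N C o)) ℚ.*_) (noCollision-impossible o g k G∸o<ko))
                     (ℚ.*-zeroʳ ((G C o) /ℕ (N C o)))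
  where
  G∸o<ko : G ∸ o < k * o
  G∸o<ko = +-cancelˡ-< o (G ∸ o) (k * o) (subst (_< o + k * o) (sym (m+[n∸m]≡n (≮⇒≥ G≮o))) G<[1+k]o)

prodℚ-reciprocal-descending : ∀ o {M} → o ≤ M → prodℚ o (λ j → 1 /ℕ (M ∸ j)) ≡ ((M ∸ o) !) /ℕ (M !)
prodℚ-reciprocal-descending zero    {M} _   = sym (n/ℕn≡1 (1≤n! M))
prodℚ-reciprocal-descending (suc o) {M} o<M = begin
  prodℚ o (λ j → 1 /ℕ (M ∸ j)) ℚ.* (1 /ℕ (M ∸ o))
    ≡⟨ cong (ℚ._* (1 /ℕ (M ∸ o))) (prodℚ-reciprocal-descending o (<⇒≤ o<M)) ⟩
  (((M ∸ o) !) /ℕ (M !)) ℚ.* (1 /ℕ (M ∸ o))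
    ≡⟨ /ℕ-*-/ℕ ((M ∸ o) !) 1 (1≤n! M) 0<M∸o ⟩
  ((M ∸ o) ! * 1) /ℕ (M ! * (M ∸ o))
    ≡⟨ /ℕ-cross (*-mono-< (1≤n! M) 0<M∸o) (1≤n! M) cross ⟩
  ((M ∸ suc o) !) /ℕ (M !)
    ∎
  where
  0<M∸o : 0 < M ∸ o
  0<M∸o = m<n⇒0<n∸m o<M
  cross : (M ∸ o) ! * 1 * M ! ≡ (M ∸ suc o) ! * (M ! * (M ∸ o))
  cross = begin
    (M ∸ o) ! * 1 * M !                  ≡⟨ cong (λ m → m * 1 * M !) ([n-k]*[n-k-1]!≡[n-k]! o<M) ⟨
    (M ∸ o) * (M ∸ suc o) ! * 1 * M !    ≡⟨ solve 3 (λ d f m → d :* f :* con 1 :* m := f :* (m :* d)) refl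
                                               (M ∸ o) ((M ∸ suc o) !) (M !) ⟩
    (M ∸ suc o) ! * (M ! * (M ∸ o))      ∎

mfactAux-fuel : ∀ {g} → 0 < g → ∀ f f′ y → y ≤ f → y ≤ f′ → mfactAux g f y ≡ mfactAux g f′ y
mfactAux-fuel 0<g zero    zero     zero    _         _          = refl
mfactAux-fuel 0<g zero    (suc f′) zero    _         _          = refl
mfactAux-fuel 0<g (suc f) zero     zero    _         _          = refl
mfactAux-fuel 0<g (suc f) (suc f′) zero    _         _          = refl
mfactAux-fuel {g} 0<g (suc f) (suc f′) (suc y) (s≤s y≤f) (s≤s y≤f′) =
  cong (suc y *_) (mfactAux-fuel 0<g f f′ (suc y ∸ g) (≤-trans 1+y∸g≤y y≤f) (≤-trans 1+y∸g≤y y≤f′))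
  where
  1+y∸g≤y : suc y ∸ g ≤ y
  1+y∸g≤y = ∸-monoʳ-≤ (suc y) 0<g

multifact-step : ∀ {g x} → 0 < g → 0 < x → multifact x g ≡ x * multifact (x ∸ g) g
multifact-step {g} {suc x} 0<g _ =
  cong (suc x *_) (mfactAux-fuel 0<g x (suc x ∸ g) (suc x ∸ g) (∸-monoʳ-≤ (suc x) 0<g) ≤-refl)

0<mfactAux : ∀ g f y → 0 < mfactAux g f y
0<mfactAux g zero    y       = s≤s z≤n
0<mfactAux g (suc f) zero    = s≤s z≤n
0<mfactAux g (suc f) (suc y) = *-mono-< (s≤s (z≤n {y})) (0<mfactAux g f (suc y ∸ g))

0<multifact : ∀ x g → 0 < multifact x g
0<multifact x g = 0<mfactAux g x x

prodℚ-reciprocal-arithmetic : ∀ {g M} → 0 < g → 0 < M → ∀ k →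
  prodℚ k (λ i → 1 /ℕ (M + g * i)) ≡ multifact (M ∸ g) g /ℕ multifact (M + g * k ∸ g) g
prodℚ-reciprocal-arithmetic {g} {M} 0<g 0<M zero =
  sym (trans (cong (λ m → multifact (M ∸ g) g /ℕ multifact (m ∸ g) g) (trans (cong (M +_) (*-zeroʳ g)) (+-identityʳ M)))
             (n/ℕn≡1 (0<multifact (M ∸ g) g)))
prodℚ-reciprocal-arithmetic {g} {M} 0<g 0<M (suc k) = begin
  prodℚ k (λ i → 1 /ℕ (M + g * i)) ℚ.* (1 /ℕ L)
    ≡⟨ cong (ℚ._* (1 /ℕ L)) (prodℚ-reciprocal-arithmetic 0<g 0<M k) ⟩
  (multifact (M ∸ g) g /ℕ multifact (L ∸ g) g) ℚ.* (1 /ℕ L)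
    ≡⟨ /ℕ-*-/ℕ (multifact (M ∸ g) g) 1 (0<multifact (L ∸ g) g) 0<L ⟩
  (multifact (M ∸ g) g * 1) /ℕ (multifact (L ∸ g) g * L)
    ≡⟨ /ℕ-cross (*-mono-< (0<multifact (L ∸ g) g) 0<L) (0<multifact (M + g * suc k ∸ g) g) cross ⟩
  multifact (M ∸ g) g /ℕ multifact (M + g * suc k ∸ g) g
    ∎
  where
  L = M + g * k
  0<L : 0 < L
  0<L = ≤-trans 0<M (m≤m+n M (g * k))
  next≡L : M + g * suc k ∸ g ≡ L
  next≡L = begin
    M + g * suc k ∸ g   ≡⟨ cong (λ m → M + m ∸ g) (trans (*-suc g k) (+-comm g (g * k))) ⟩
    M + (g * k + g) ∸ g ≡⟨ cong (_∸ g) (+-assoc M (g * k) g) ⟨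
    L + g ∸ g           ≡⟨ m+n∸n≡m L g ⟩
    L                   ∎
  cross : multifact (M ∸ g) g * 1 * multifact (M + g * suc k ∸ g) g ≡ multifact (M ∸ g) g * (multifact (L ∸ g) g * L)
  cross = begin
    multifact (M ∸ g) g * 1 * multifact (M + g * suc k ∸ g) g
      ≡⟨ cong (λ m → multifact (M ∸ g) g * 1 * multifact m g) next≡L ⟩
    multifact (M ∸ g) g * 1 * multifact L g
      ≡⟨ cong (multifact (M ∸ g) g * 1 *_) (multifact-step 0<g 0<L) ⟩
    multifact (M ∸ g) g * 1 * (L * multifact (L ∸ g) g)
      ≡⟨ solve 3 (λ a l b → a :* con 1 :* (l :* b) := a :* (b :* l)) refl
           (multifact (M ∸ g) g) L (multifact (L ∸ g) g) ⟩
    multifact (M ∸ g) g * (multifact (L ∸ g) g * L)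
      ∎

prodℚ-reciprocal-constant : ∀ {M} → 0 < M → ∀ k → prodℚ k (λ _ → 1 /ℕ M) ≡ 1 /ℕ (M ^ k)
prodℚ-reciprocal-constant {M} 0<M zero    = refl
prodℚ-reciprocal-constant {M} 0<M (suc k) = begin
  prodℚ k (λ _ → 1 /ℕ M) ℚ.* (1 /ℕ M)  ≡⟨ cong (ℚ._* (1 /ℕ M)) (prodℚ-reciprocal-constant 0<M k) ⟩
  (1 /ℕ (M ^ k)) ℚ.* (1 /ℕ M)         ≡⟨ /ℕ-*-/ℕ 1 1 0<M^k 0<M ⟩
  1 /ℕ (M ^ k * M)                     ≡⟨ cong (1 /ℕ_) (*-comm (M ^ k) M) ⟩
  1 /ℕ (M ^ suc k)                     ∎
  where
  0<M^k : 0 < M ^ k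
  0<M^k = m^n>0 M {{>-nonZero 0<M}} k

m∸n∸o≡m∸o∸n : ∀ m n o → m ∸ n ∸ o ≡ m ∸ o ∸ n
m∸n∸o≡m∸o∸n m n o = trans (∸-+-assoc m n o) (trans (cong (m ∸_) (+-comm n o)) (sym (∸-+-assoc m o n)))

PrCollGe≡noCollision : ∀ {n r} o g k → r ≤ n → PrCollGe n r o g k ≡ noCollision o g k n (n ∸ r)
PrCollGe≡noCollision {n} {r} o g k r≤n =
  trans (ProbNoCollision≡noCollision o g k (initial n r)) (cong₂ (noCollision o g k) length-initial greens-initial)
  where
  length-initial : length (initial n r) ≡ n
  length-initial = trans (length-++ (replicate r true))
    (trans (cong₂ _+_ (length-replicate r) (length-replicate (n ∸ r))) (m+[n∸m]≡n r≤n))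
  greens-initial : greens (initial n r) ≡ n ∸ r
  greens-initial = trans (countᵇ-++ not (replicate r true) (replicate (n ∸ r) false))
    (cong₂ _+_ (greens-replicate-true r) (greens-replicate-false (n ∸ r)))

PrCollGe-closed : ∀ {n r o} g k → o ≤ n → r ≤ n → k * o ≤ n ∸ r →
  PrCollGe n r o g k ≡
    (((n ∸ r) !) /ℕ ((n ∸ r ∸ k * o) !)) ℚ.* prodℚ o (λ j → prodℚ k (λ i → 1 /ℕ (n ∸ j + g * i)))
PrCollGe-closed {n} {r} {o} g k o≤n r≤n ko≤n∸r = begin
  PrCollGe n r o g k
    ≡⟨ PrCollGe≡noCollision o g k r≤n ⟩
  noCollision o g k n (n ∸ r)
    ≡⟨ noCollision-closed o g k o≤n ko≤n∸r ⟩
  X ℚ.* prodℚ k (λ i → ((n + g * i ∸ o) !) /ℕ ((n + g * i) !))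
    ≡⟨ cong (X ℚ.*_) (prodℚ-cong k (λ {i} _ → sym (prodℚ-reciprocal-descending o (≤-trans o≤n (m≤m+n n (g * i)))))) ⟩
  X ℚ.* prodℚ k (λ i → prodℚ o (λ j → 1 /ℕ (n + g * i ∸ j)))
    ≡⟨ cong (X ℚ.*_) (prodℚ-swap k o (λ i j → 1 /ℕ (n + g * i ∸ j))) ⟩
  X ℚ.* prodℚ o (λ j → prodℚ k (λ i → 1 /ℕ (n + g * i ∸ j)))
    ≡⟨ cong (X ℚ.*_) (prodℚ-cong o (λ j<o → prodℚ-cong k (λ {i} _ →
         cong (1 /ℕ_) (+-∸-comm (g * i) (≤-trans (<⇒≤ j<o) o≤n))))) ⟩
  X ℚ.* prodℚ o (λ j → prodℚ k (λ i → 1 /ℕ (n ∸ j + g * i)))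
    ∎
  where
  X = ((n ∸ r) !) /ℕ ((n ∸ r ∸ k * o) !)

lemma20 : (n r o g : ℕ) → 1 ≤ o → o ≤ n → r ≤ n → (k : ℕ) →
    (k * o ≤ n ∸ r → g > 0 →
      PrCollGe n r o g k ≡
        Data.Rational._*_ (((n ∸ r) !) /ℕ ((n ∸ r ∸ k * o) !))
          (prodℚ o (λ j → multifact (n ∸ g ∸ j) g /ℕ multifact (n + g * k ∸ g ∸ j) g)))
    × (k * o ≤ n ∸ r → g ≡ 0 →
      PrCollGe n r o g k ≡
        Data.Rational._*_ (((n ∸ r) !) /ℕ ((n ∸ r ∸ k * o) !))
          (prodℚ o (λ j → 1 /ℕ ((n ∸ j) ^ k))))
    × (n ∸ r < k * o → PrCollGe n r o g k ≡ 0ℚ)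
lemma20 n r o g _ o≤n r≤n k =
    (λ ko≤n∸r 0<g → trans (PrCollGe-closed g k o≤n r≤n ko≤n∸r)
                          (cong (X ℚ.*_) (prodℚ-cong o (arithmetic 0<g))))
  , (λ { ko≤n∸r refl → trans (PrCollGe-closed 0 k o≤n r≤n ko≤n∸r)
                             (cong (X ℚ.*_) (prodℚ-cong o constant)) })
  , (λ n∸r<ko → trans (PrCollGe≡noCollision o g k r≤n) (noCollision-impossible o g k n∸r<ko))
  where
  X = ((n ∸ r) !) /ℕ ((n ∸ r ∸ k * o) !)
  0<n∸j : ∀ {j} → j < o → 0 < n ∸ j
  0<n∸j j<o = m<n⇒0<n∸m (≤-trans j<o o≤n)
  arithmetic : 0 < g → ∀ {j} → j < o →
    prodℚ k (λ i → 1 /ℕ (n ∸ j + g * i)) ≡ multifact (n ∸ g ∸ j) g /ℕ multifact (n + g * k ∸ g ∸ j) g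
  arithmetic 0<g {j} j<o = trans (prodℚ-reciprocal-arithmetic 0<g (0<n∸j j<o) k)
    (cong₂ (λ a b → multifact a g /ℕ multifact b g)
      (m∸n∸o≡m∸o∸n n j g)
      (trans (cong (_∸ g) (sym (+-∸-comm (g * k) (≤-trans (<⇒≤ j<o) o≤n)))) (m∸n∸o≡m∸o∸n (n + g * k) j g)))
  constant : ∀ {j} → j < o → prodℚ k (λ i → 1 /ℕ (n ∸ j + 0 * i)) ≡ 1 /ℕ ((n ∸ j) ^ k)
  constant {j} j<o = trans (prodℚ-cong k (λ _ → cong (1 /ℕ_) (+-identityʳ (n ∸ j))))
                           (prodℚ-reciprocal-constant (0<n∸j j<o) k)
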